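{- Let $G=(V,E)$ be a graph on $n$ vertices and let $k$ be an integer with $0 \le k \le n$. Then $$(k + 1)\bigl(d_{k + 1}(G) - d_k(G)\bigr) = \sum_{T \subseteq V,\ T\neq \emptyset} E_k^T\, D(T) - (2k + 1 - n)\,d_k(G).$$
   Context: All graphs are finite, undirected and simple. For $S \subseteq V$, the (closed) neighborhood $N(S)$ is the set of vertices that are in $S$ or adjacent to a vertex of $S$. A set $S$ dominates a set $T$ if $T \subseteq N(S)$; a single vertex $v$ dominates $T$ if $T \subseteq N(\{v\})$, and a set $U$ dominates a vertex $w$ if $w \in N(U)$. $S$ is dominating if $N(S)=V$. $d_i(G)$ is the number of $i$-element dominating sets of $G$ (so $d_{n+1}(G)=0$). For $S \subseteq V$, $D(S)$ is the number of vertices $v \in V$ such that $\{v\}$ dominates $S$, and $E_k^S$ is the number of $k$-element subsets $U \subseteq V$ that dominate $V \setminus S$ but dominate no vertex of $S$. -}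

module Defs where

open import Data.Bool using (Bool; true; false; _∧_; _∨_; not; if_then_else_; T)
open import Data.Nat using (ℕ; zero; suc; _≡ᵇ_)
open import Data.Fin using (Fin)
open import Data.List using (List; []; _∷_; map; _++_)
open import Data.Bool.ListAction using (all; any)
open import Data.Nat.ListAction using (sum)
open import Data.List.Base using (allFin)
open import Data.Vec using (Vec; []; _∷_; lookup)
open import Data.Fin.Subset using (Subset; ∁; ⁅_⁆; ∣_∣; Nonempty)
open import Relation.Binary.PropositionalEquality using (_≡_)

record Graph (n : ℕ) : Set where
  field
    adj    : Fin n → Fin n → Bool
    sym    : ∀ u v → adj u v ≡ adj v u
    irrefl : ∀ v → adj v v ≡ false
open Graph public

vertices : (n : ℕ) → List (Fin n)
vertices n = allFin n

allSubsets : (n : ℕ) → List (Subset n)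
allSubsets zero    = [] ∷ []
allSubsets (suc n) = map (false ∷_) (allSubsets n) ++ map (true ∷_) (allSubsets n)

countL : ∀ {A : Set} → (A → Bool) → List A → ℕ
countL p []       = 0
countL p (x ∷ xs) = if p x then suc (countL p xs) else countL p xs

inN : ∀ {n} → Graph n → Subset n → Fin n → Bool
inN {n} G S w = lookup S w ∨ any (λ v → lookup S v ∧ adj G v w) (vertices n)

dominates : ∀ {n} → Graph n → Subset n → Subset n → Bool
dominates {n} G S T = all (λ w → not (lookup T w) ∨ inN G S w) (vertices n)

dominatesNone : ∀ {n} → Graph n → Subset n → Subset n → Bool
dominatesNone {n} G S T = all (λ w → not (lookup T w ∧ inN G S w)) (vertices n)

isDominating : ∀ {n} → Graph n → Subset n → Bool
isDominating {n} G S = all (λ w → inN G S w) (vertices n)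

d : ∀ {n} → Graph n → ℕ → ℕ
d {n} G i = countL (λ S → (∣ S ∣ ≡ᵇ i) ∧ isDominating G S) (allSubsets n)

D : ∀ {n} → Graph n → Subset n → ℕ
D {n} G S = countL (λ v → dominates G ⁅ v ⁆ S) (vertices n)

E : ∀ {n} → Graph n → ℕ → Subset n → ℕ
E {n} G k S =
  countL (λ U → (∣ U ∣ ≡ᵇ k) ∧ (dominates G U (∁ S) ∧ dominatesNone G U S)) (allSubsets n)

nonemptyᵇ : ∀ {n} → Subset n → Bool
nonemptyᵇ {n} S = any (λ v → lookup S v) (vertices n)

sumETDT : ∀ {n} → Graph n → ℕ → ℕ
sumETDT {n} G k =
  sum (map (λ T → if nonemptyᵇ T then E G k T Data.Nat.* D G T else 0) (allSubsets n))

-- For a k-set U let T_U = V ∖ N(U). A set U is counted by E_k^T exactly when T = T_U, and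
-- D(T_U) is the number e(U) of vertices v for which U ∪ {v} is dominating; T_U is nonempty
-- exactly when U is not dominating, while e(U) = n when it is. Hence both
-- Σ_T E_k^T D(T) + n d_k and k d_k + (k+1) d_{k+1} count the pairs (U, v) with |U| = k and
-- U ∪ {v} dominating: the first sorts them by whether U dominates, the second by whether
-- v ∈ U. The theorem is a rearrangement of this identity over ℤ.
module Submission where

open import Defs hiding (sym)
open import Algebra.Bundles using (CommutativeMonoid)
open import Data.Bool using (Bool; true; false; _∧_; _∨_; not; if_then_else_)
open import Data.Bool.ListAction using (all; any; and; or)
open import Data.Bool.Properties using (T-≡; ∧-conicalˡ; ∧-conicalʳ; ∧-identityʳ; ∧-distribʳ-∨; not-involutive; ∨-commutativeMonoid)
open import Data.Fin using (Fin; zero; suc)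
open import Data.Fin.Subset using (Subset; ∁; ⁅_⁆; ∣_∣; _∪_; ⊥)
open import Data.Fin.Subset.Properties using (∪-identityʳ)
open import Data.List using (List; []; _∷_; map; _++_; tabulate; allFin)
open import Data.List.Properties using (map-++; map-∘; map-cong)
open import Data.Nat using (ℕ; zero; suc; _≤_)
open import Data.Nat.ListAction using (sum)
open import Data.Nat.ListAction.Properties using (sum-++)
open import Data.Vec using ([]; _∷_; lookup)
import Data.Vec as Vec
open import Data.Vec.Properties using (∷-injectiveʳ; lookup-map; lookup-zipWith; lookup∘tabulate; tabulate∘lookup; tabulate-cong)
open import Data.Empty using (⊥-elim)
open import Function using (_∘_; id)
open import Function.Bundles using (Equivalence)
open import Relation.Binary.PropositionalEquality using (_≡_; _≢_; _≗_; refl; sym; trans; cong; cong₂; module ≡-Reasoning)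

open import Algebra.Properties.CommutativeSemigroup (CommutativeMonoid.commutativeSemigroup ∨-commutativeMonoid) using () renaming (interchange to ∨-interchange)

-- ℕ arithmetic is opened only in this module: the theorem at the end is stated with the ℤ operators.
module _ where
  open import Data.Nat using (_+_; _*_; _≡ᵇ_)
  open import Data.Nat.Properties
    using (+-identityʳ; +-comm; *-zeroʳ; *-identityʳ; *-distribˡ-+; *-distribʳ-+; *-comm; ≡ᵇ⇒≡;
           +-commutativeSemigroup; *-commutativeSemigroup; +-*-semiring)
  open import Algebra.Properties.Semiring.Sum +-*-semiring using (sum-syntax; sum-cong-≗; ∑-distrib-+; *-distribˡ-sum)
  open import Algebra.Properties.CommutativeSemigroup *-commutativeSemigroup using (x∙yz≈y∙xz)
  open import Algebra.Properties.CommutativeSemigroup +-commutativeSemigroup using () renaming (interchange to +-interchange)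

  𝟙 : Bool → ℕ
  𝟙 b = if b then 1 else 0

  𝟙-∧ : ∀ a b → 𝟙 (a ∧ b) ≡ 𝟙 a * 𝟙 b
  𝟙-∧ true  b = sym (+-identityʳ (𝟙 b))
  𝟙-∧ false b = refl

  *-𝟙≡ᵇ : ∀ a b y → a * (𝟙 (a ≡ᵇ b) * y) ≡ b * (𝟙 (a ≡ᵇ b) * y)
  *-𝟙≡ᵇ a b y with a ≡ᵇ b in a≡ᵇb
  ... | true  = cong (_* (1 * y)) (≡ᵇ⇒≡ a b (Equivalence.from T-≡ a≡ᵇb))
  ... | false = trans (*-zeroʳ a) (sym (*-zeroʳ b))

  if-then-0 : ∀ b x → (if b then x else 0) ≡ 𝟙 b * x
  if-then-0 true  x = sym (+-identityʳ x)
  if-then-0 false x = refl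

  ∑-1 : ∀ n → ∑[ i < n ] 1 ≡ n
  ∑-1 zero    = refl
  ∑-1 (suc n) = cong suc (∑-1 n)

  ∑-lookup : ∀ {n} (U : Subset n) c → ∑[ v < n ] (if lookup U v then c else 0) ≡ ∣ U ∣ * c
  ∑-lookup []          c = refl
  ∑-lookup (true ∷ U)  c = cong (c +_) (∑-lookup U c)
  ∑-lookup (false ∷ U) c = ∑-lookup U c

  countL≡sum-𝟙 : ∀ {A : Set} (p : A → Bool) xs → countL p xs ≡ sum (map (𝟙 ∘ p) xs)
  countL≡sum-𝟙 p []       = refl
  countL≡sum-𝟙 p (x ∷ xs) with p x
  ... | true  = cong suc (countL≡sum-𝟙 p xs)
  ... | false = countL≡sum-𝟙 p xs

  sum-map-tabulate : ∀ {A : Set} {n} (f : A → ℕ) (g : Fin n → A) → sum (map f (tabulate g)) ≡ ∑[ i < n ] f (g i)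
  sum-map-tabulate {n = zero}  f g = refl
  sum-map-tabulate {n = suc n} f g = cong (f (g zero) +_) (sum-map-tabulate f (g ∘ suc))

  countL-allFin : ∀ {n} (p : Fin n → Bool) → countL p (allFin n) ≡ ∑[ i < n ] 𝟙 (p i)
  countL-allFin {n} p = trans (countL≡sum-𝟙 p (allFin n)) (sum-map-tabulate (𝟙 ∘ p) id)

  ∑ˢ : ∀ {n} → (Subset n → ℕ) → ℕ
  ∑ˢ {zero}  f = f []
  ∑ˢ {suc n} f = ∑ˢ (f ∘ (false ∷_)) + ∑ˢ (f ∘ (true ∷_))

  infixl 10 ∑ˢ
  syntax ∑ˢ (λ U → e) = ∑ˢ[ U ] e

  ∑ˢ-cong : ∀ {n} {f g : Subset n → ℕ} → f ≗ g → ∑ˢ f ≡ ∑ˢ g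
  ∑ˢ-cong {zero}  f≗g = f≗g []
  ∑ˢ-cong {suc n} f≗g = cong₂ _+_ (∑ˢ-cong (f≗g ∘ (false ∷_))) (∑ˢ-cong (f≗g ∘ (true ∷_)))

  ∑ˢ-zero : ∀ {n} {f : Subset n → ℕ} → (∀ U → f U ≡ 0) → ∑ˢ f ≡ 0
  ∑ˢ-zero {zero}  f≡0 = f≡0 []
  ∑ˢ-zero {suc n} f≡0 = cong₂ _+_ (∑ˢ-zero (f≡0 ∘ (false ∷_))) (∑ˢ-zero (f≡0 ∘ (true ∷_)))

  ∑ˢ-distrib-+ : ∀ {n} (f g : Subset n → ℕ) → ∑ˢ[ U ] (f U + g U) ≡ ∑ˢ f + ∑ˢ g
  ∑ˢ-distrib-+ {zero}  f g = refl
  ∑ˢ-distrib-+ {suc n} f g =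
    trans (cong₂ _+_ (∑ˢ-distrib-+ (f ∘ (false ∷_)) (g ∘ (false ∷_))) (∑ˢ-distrib-+ (f ∘ (true ∷_)) (g ∘ (true ∷_))))
          (+-interchange (∑ˢ (f ∘ (false ∷_))) (∑ˢ (g ∘ (false ∷_))) (∑ˢ (f ∘ (true ∷_))) (∑ˢ (g ∘ (true ∷_))))

  *-distribˡ-∑ˢ : ∀ {n} c (f : Subset n → ℕ) → c * ∑ˢ f ≡ ∑ˢ[ U ] (c * f U)
  *-distribˡ-∑ˢ {zero}  c f = refl
  *-distribˡ-∑ˢ {suc n} c f =
    trans (*-distribˡ-+ c _ _)
          (cong₂ _+_ (*-distribˡ-∑ˢ c (f ∘ (false ∷_))) (*-distribˡ-∑ˢ c (f ∘ (true ∷_))))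

  *-distribʳ-∑ˢ : ∀ {n} c (f : Subset n → ℕ) → ∑ˢ f * c ≡ ∑ˢ[ U ] (f U * c)
  *-distribʳ-∑ˢ {zero}  c f = refl
  *-distribʳ-∑ˢ {suc n} c f =
    trans (*-distribʳ-+ c (∑ˢ (f ∘ (false ∷_))) (∑ˢ (f ∘ (true ∷_))))
          (cong₂ _+_ (*-distribʳ-∑ˢ c (f ∘ (false ∷_))) (*-distribʳ-∑ˢ c (f ∘ (true ∷_))))

  ∑ˢ-comm : ∀ {m n} (h : Subset m → Subset n → ℕ) → ∑ˢ[ U ] ∑ˢ[ W ] h U W ≡ ∑ˢ[ W ] ∑ˢ[ U ] h U W
  ∑ˢ-comm {zero}  h = refl
  ∑ˢ-comm {suc m} h = trans (cong₂ _+_ (∑ˢ-comm (h ∘ (false ∷_))) (∑ˢ-comm (h ∘ (true ∷_))))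
                             (sym (∑ˢ-distrib-+ (λ W → ∑ˢ[ U ] h (false ∷ U) W) (λ W → ∑ˢ[ U ] h (true ∷ U) W)))

  ∑ˢ-∑-comm : ∀ {m n} (h : Subset m → Fin n → ℕ) → ∑ˢ[ U ] ∑[ v < n ] h U v ≡ ∑[ v < n ] ∑ˢ[ U ] h U v
  ∑ˢ-∑-comm {m} {zero}  h = ∑ˢ-zero {m} (λ _ → refl)
  ∑ˢ-∑-comm {m} {suc n} h =
    trans (∑ˢ-distrib-+ (λ U → h U zero) (λ U → ∑[ v < n ] h U (suc v)))
          (cong (∑ˢ[ U ] h U zero +_) (∑ˢ-∑-comm (λ U v → h U (suc v))))

  ∑ˢ-delta : ∀ {n} (T₀ : Subset n) {f : Subset n → ℕ} → (∀ T → T ≢ T₀ → f T ≡ 0) → ∑ˢ f ≡ f T₀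
  ∑ˢ-delta []           f≡0 = refl
  ∑ˢ-delta (false ∷ T₀) f≡0 = trans
    (cong₂ _+_ (∑ˢ-delta T₀ (λ T T≢T₀ → f≡0 (false ∷ T) (T≢T₀ ∘ ∷-injectiveʳ))) (∑ˢ-zero (λ T → f≡0 (true ∷ T) λ ())))
    (+-identityʳ _)
  ∑ˢ-delta (true ∷ T₀)  f≡0 =
    cong₂ _+_ (∑ˢ-zero (λ T → f≡0 (false ∷ T) λ ())) (∑ˢ-delta T₀ (λ T T≢T₀ → f≡0 (true ∷ T) (T≢T₀ ∘ ∷-injectiveʳ)))

  sum-map-allSubsets : ∀ n (f : Subset n → ℕ) → sum (map f (allSubsets n)) ≡ ∑ˢ f
  sum-map-allSubsets zero    f = +-identityʳ (f [])
  sum-map-allSubsets (suc n) f = begin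
    sum (map f (map (false ∷_) S ++ map (true ∷_) S))
      ≡⟨ cong sum (map-++ f (map (false ∷_) S) (map (true ∷_) S)) ⟩
    sum (map f (map (false ∷_) S) ++ map f (map (true ∷_) S))
      ≡⟨ sum-++ (map f (map (false ∷_) S)) (map f (map (true ∷_) S)) ⟩
    sum (map f (map (false ∷_) S)) + sum (map f (map (true ∷_) S))
      ≡⟨ cong₂ _+_ (half false) (half true) ⟩
    ∑ˢ (f ∘ (false ∷_)) + ∑ˢ (f ∘ (true ∷_)) ∎
    where
    open ≡-Reasoning
    S : List (Subset n)
    S = allSubsets n
    half : ∀ b → sum (map f (map (b ∷_) S)) ≡ ∑ˢ (f ∘ (b ∷_))
    half b = trans (cong sum (sym (map-∘ S))) (sum-map-allSubsets n (f ∘ (b ∷_)))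

  countL-allSubsets : ∀ {n} (p : Subset n → Bool) → countL p (allSubsets n) ≡ ∑ˢ (𝟙 ∘ p)
  countL-allSubsets {n} p = trans (countL≡sum-𝟙 p (allSubsets n)) (sum-map-allSubsets n (𝟙 ∘ p))

  p∪⁅x⁆≡p : ∀ {n} (p : Subset n) (x : Fin n) → lookup p x ≡ true → p ∪ ⁅ x ⁆ ≡ p
  p∪⁅x⁆≡p (true ∷ p)  zero    _   = cong (true ∷_) (∪-identityʳ p)
  p∪⁅x⁆≡p (false ∷ p) (suc x) x∈p = cong (false ∷_) (p∪⁅x⁆≡p p x x∈p)
  p∪⁅x⁆≡p (true ∷ p)  (suc x) x∈p = cong (true ∷_) (p∪⁅x⁆≡p p x x∈p)

  ∣p∪⁅x⁆∣≡1+∣p∣ : ∀ {n} (p : Subset n) (x : Fin n) → lookup p x ≡ false → ∣ p ∪ ⁅ x ⁆ ∣ ≡ suc ∣ p ∣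
  ∣p∪⁅x⁆∣≡1+∣p∣ (false ∷ p) zero    _   = cong (suc ∘ ∣_∣) (∪-identityʳ p)
  ∣p∪⁅x⁆∣≡1+∣p∣ (false ∷ p) (suc x) x∉p = ∣p∪⁅x⁆∣≡1+∣p∣ p x x∉p
  ∣p∪⁅x⁆∣≡1+∣p∣ (true ∷ p)  (suc x) x∉p = cong suc (∣p∪⁅x⁆∣≡1+∣p∣ p x x∉p)

  ∑ˢ-∪⁅⁆ : ∀ {n} (v : Fin n) (h : Subset n → ℕ) →
           ∑ˢ[ U ] (if lookup U v then 0 else h (U ∪ ⁅ v ⁆)) ≡ ∑ˢ[ W ] (if lookup W v then h W else 0)
  ∑ˢ-∪⁅⁆ {suc n} zero h = begin
    ∑ˢ[ U ] h (true ∷ (U ∪ ⊥)) + ∑ˢ {n} (λ _ → 0)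
      ≡⟨ cong₂ _+_ (∑ˢ-cong (cong (h ∘ (true ∷_)) ∘ ∪-identityʳ)) (∑ˢ-zero {n} (λ _ → refl)) ⟩
    ∑ˢ[ U ] h (true ∷ U) + 0
      ≡⟨ +-comm _ 0 ⟩
    0 + ∑ˢ[ U ] h (true ∷ U)
      ≡⟨ cong (_+ ∑ˢ[ U ] h (true ∷ U)) (sym (∑ˢ-zero {n} (λ _ → refl))) ⟩
    ∑ˢ {n} (λ _ → 0) + ∑ˢ[ U ] h (true ∷ U) ∎
    where open ≡-Reasoning
  ∑ˢ-∪⁅⁆ {suc n} (suc v) h = cong₂ _+_ (∑ˢ-∪⁅⁆ v (h ∘ (false ∷_))) (∑ˢ-∪⁅⁆ v (h ∘ (true ∷_)))

  -- Both sides count pairs (W, v) with v ∈ W, weighted by h W: on the left W = U ∪ {v} with v ∉ U.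
  ∑ˢ-insertions : ∀ {n} (h : Subset n → ℕ) →
               ∑ˢ[ U ] ∑[ v < n ] (if lookup U v then 0 else h (U ∪ ⁅ v ⁆)) ≡ ∑ˢ[ W ] (∣ W ∣ * h W)
  ∑ˢ-insertions {n} h = begin
    ∑ˢ[ U ] ∑[ v < n ] (if lookup U v then 0 else h (U ∪ ⁅ v ⁆))
      ≡⟨ ∑ˢ-∑-comm (λ U v → if lookup U v then 0 else h (U ∪ ⁅ v ⁆)) ⟩
    ∑[ v < n ] ∑ˢ[ U ] (if lookup U v then 0 else h (U ∪ ⁅ v ⁆))
      ≡⟨ sum-cong-≗ (λ v → ∑ˢ-∪⁅⁆ v h) ⟩
    ∑[ v < n ] ∑ˢ[ W ] (if lookup W v then h W else 0)
      ≡⟨ sym (∑ˢ-∑-comm (λ W v → if lookup W v then h W else 0)) ⟩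
    ∑ˢ[ W ] ∑[ v < n ] (if lookup W v then h W else 0)
      ≡⟨ ∑ˢ-cong (λ W → ∑-lookup W (h W)) ⟩
    ∑ˢ[ W ] (∣ W ∣ * h W) ∎
    where open ≡-Reasoning

  all-cong : ∀ {A : Set} {p q : A → Bool} → p ≗ q → ∀ xs → all p xs ≡ all q xs
  all-cong p≗q xs = cong and (map-cong p≗q xs)

  any-cong : ∀ {A : Set} {p q : A → Bool} → p ≗ q → ∀ xs → any p xs ≡ any q xs
  any-cong p≗q xs = cong or (map-cong p≗q xs)

  all-mono : ∀ {A : Set} {p q : A → Bool} → (∀ x → p x ≡ true → q x ≡ true) → ∀ xs → all p xs ≡ true → all q xs ≡ true
  all-mono p⇒q []       _ = refl
  all-mono p⇒q (x ∷ xs) e = cong₂ _∧_ (p⇒q x (∧-conicalˡ _ _ e)) (all-mono p⇒q xs (∧-conicalʳ _ _ e))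

  all-tabulate⁻ : ∀ {A : Set} {n} {p : A → Bool} (f : Fin n → A) → all p (tabulate f) ≡ true → ∀ i → p (f i) ≡ true
  all-tabulate⁻ f e zero    = ∧-conicalˡ _ _ e
  all-tabulate⁻ f e (suc i) = all-tabulate⁻ (f ∘ suc) (∧-conicalʳ _ _ e) i

  all-tabulate⁺ : ∀ {A : Set} {n} {p : A → Bool} (f : Fin n → A) → (∀ i → p (f i) ≡ true) → all p (tabulate f) ≡ true
  all-tabulate⁺ {n = zero}  f _  = refl
  all-tabulate⁺ {n = suc n} f pf = cong₂ _∧_ (pf zero) (all-tabulate⁺ (f ∘ suc) (pf ∘ suc))

  any-not : ∀ {A : Set} (p : A → Bool) xs → any (not ∘ p) xs ≡ not (all p xs)
  any-not p []       = refl
  any-not p (x ∷ xs) with p x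
  ... | true  = any-not p xs
  ... | false = refl

  any-∨ : ∀ {A : Set} (p q : A → Bool) xs → any (λ x → p x ∨ q x) xs ≡ any p xs ∨ any q xs
  any-∨ p q []       = refl
  any-∨ p q (x ∷ xs) = trans (cong ((p x ∨ q x) ∨_) (any-∨ p q xs)) (∨-interchange (p x) (q x) (any p xs) (any q xs))

  module _ {n : ℕ} (G : Graph n) where

    inN-∪ : ∀ U W w → inN G (U ∪ W) w ≡ inN G U w ∨ inN G W w
    inN-∪ U W w = begin
      lookup (U ∪ W) w ∨ any (λ v → lookup (U ∪ W) v ∧ adj G v w) (vertices n)
        ≡⟨ cong₂ _∨_ (lookup-zipWith _∨_ w U W) (any-cong distrib (vertices n)) ⟩
      (lookup U w ∨ lookup W w) ∨ any (λ v → from U v ∨ from W v) (vertices n)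
        ≡⟨ cong ((lookup U w ∨ lookup W w) ∨_) (any-∨ (from U) (from W) (vertices n)) ⟩
      (lookup U w ∨ lookup W w) ∨ (any (from U) (vertices n) ∨ any (from W) (vertices n))
        ≡⟨ ∨-interchange (lookup U w) (lookup W w) _ _ ⟩
      inN G U w ∨ inN G W w ∎
      where
      open ≡-Reasoning
      from : Subset n → Fin n → Bool
      from S v = lookup S v ∧ adj G v w
      distrib : ∀ v → lookup (U ∪ W) v ∧ adj G v w ≡ from U v ∨ from W v
      distrib v = trans (cong (_∧ adj G v w) (lookup-zipWith _∨_ v U W)) (∧-distribʳ-∨ (adj G v w) (lookup U v) (lookup W v))

    isDominating-∪ : ∀ U W → isDominating G U ≡ true → isDominating G (U ∪ W) ≡ true
    isDominating-∪ U W = all-mono (λ w w∈NU → trans (inN-∪ U W w) (cong (_∨ inN G W w) w∈NU)) (vertices n)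

    undominated : Subset n → Subset n
    undominated U = Vec.tabulate (λ w → not (inN G U w))

    lookup-undominated : ∀ U w → lookup (undominated U) w ≡ not (inN G U w)
    lookup-undominated U = lookup∘tabulate (λ w → not (inN G U w))

    nonempty-undominated : ∀ U → nonemptyᵇ (undominated U) ≡ not (isDominating G U)
    nonempty-undominated U = trans (any-cong (lookup-undominated U) (vertices n)) (any-not (inN G U) (vertices n))

    dominates-undominated : ∀ U W → dominates G W (undominated U) ≡ isDominating G (U ∪ W)
    dominates-undominated U W = all-cong pointwise (vertices n)
      where
      pointwise : ∀ w → not (lookup (undominated U) w) ∨ inN G W w ≡ inN G (U ∪ W) w
      pointwise w = begin
        not (lookup (undominated U) w) ∨ inN G W w  ≡⟨ cong (λ b → not b ∨ inN G W w) (lookup-undominated U w) ⟩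
        not (not (inN G U w)) ∨ inN G W w           ≡⟨ cong (_∨ inN G W w) (not-involutive (inN G U w)) ⟩
        inN G U w ∨ inN G W w                       ≡⟨ sym (inN-∪ U W w) ⟩
        inN G (U ∪ W) w                             ∎
        where open ≡-Reasoning

    leavesExactly : Subset n → Subset n → Bool
    leavesExactly U T = dominates G U (∁ T) ∧ dominatesNone G U T

    leavesExactly⇒≡undominated : ∀ U T → leavesExactly U T ≡ true → T ≡ undominated U
    leavesExactly⇒≡undominated U T e =
      trans (sym (tabulate∘lookup T)) (tabulate-cong (λ w → pointwise (lookup T w) (inN G U w) (covers w) (misses w)))
      where
      covers : ∀ w → not (not (lookup T w)) ∨ inN G U w ≡ true
      covers w = trans (cong (λ b → not b ∨ inN G U w) (sym (lookup-map w not T)))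
                       (all-tabulate⁻ id (∧-conicalˡ _ _ e) w)
      misses : ∀ w → not (lookup T w ∧ inN G U w) ≡ true
      misses = all-tabulate⁻ id (∧-conicalʳ _ _ e)
      pointwise : ∀ t x → not (not t) ∨ x ≡ true → not (t ∧ x) ≡ true → t ≡ not x
      pointwise true  false _  _  = refl
      pointwise false true  _  _  = refl
      pointwise true  true  _  ()
      pointwise false false () _

    leavesExactly-undominated : ∀ U → leavesExactly U (undominated U) ≡ true
    leavesExactly-undominated U = cong₂ _∧_ (all-tabulate⁺ id covers) (all-tabulate⁺ id misses)
      where
      covers : ∀ w → not (lookup (∁ (undominated U)) w) ∨ inN G U w ≡ true
      covers w = trans (cong (λ b → not b ∨ inN G U w)
                             (trans (lookup-map w not (undominated U)) (cong not (lookup-undominated U w))))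
                       (pointwise (inN G U w))
        where
        pointwise : ∀ x → not (not (not x)) ∨ x ≡ true
        pointwise true  = refl
        pointwise false = refl
      misses : ∀ w → not (lookup (undominated U) w ∧ inN G U w) ≡ true
      misses w = trans (cong (λ b → not (b ∧ inN G U w)) (lookup-undominated U w)) (pointwise (inN G U w))
        where
        pointwise : ∀ x → not (not x ∧ x) ≡ true
        pointwise true  = refl
        pointwise false = refl

    extensions : Subset n → ℕ
    extensions U = ∑[ v < n ] 𝟙 (isDominating G (U ∪ ⁅ v ⁆))

    D-undominated : ∀ U → D G (undominated U) ≡ extensions U
    D-undominated U = trans (countL-allFin (λ v → dominates G ⁅ v ⁆ (undominated U)))
                            (sum-cong-≗ (λ v → cong 𝟙 (dominates-undominated U ⁅ v ⁆)))

    extensions-dominating : ∀ U → isDominating G U ≡ true → extensions U ≡ n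
    extensions-dominating U U-dom = trans (sum-cong-≗ (λ v → cong 𝟙 (isDominating-∪ U ⁅ v ⁆ U-dom))) (∑-1 n)

    extensions-split : ∀ U → extensions U ≡
      ∣ U ∣ * 𝟙 (isDominating G U) + ∑[ v < n ] (if lookup U v then 0 else 𝟙 (isDominating G (U ∪ ⁅ v ⁆)))
    extensions-split U = begin
      ∑[ v < n ] 𝟙 (isDominating G (U ∪ ⁅ v ⁆))                                 ≡⟨ sum-cong-≗ split ⟩
      ∑[ v < n ] (inside v + outside v)                                          ≡⟨ ∑-distrib-+ inside outside ⟩
      ∑[ v < n ] inside v + ∑[ v < n ] outside v                                 ≡⟨ cong (_+ ∑[ v < n ] outside v) (∑-lookup U _) ⟩
      ∣ U ∣ * 𝟙 (isDominating G U) + ∑[ v < n ] outside v                        ∎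
      where
      open ≡-Reasoning
      inside outside : Fin n → ℕ
      inside v = if lookup U v then 𝟙 (isDominating G U) else 0
      outside v = if lookup U v then 0 else 𝟙 (isDominating G (U ∪ ⁅ v ⁆))
      split : ∀ v → 𝟙 (isDominating G (U ∪ ⁅ v ⁆)) ≡ inside v + outside v
      split v with lookup U v in v∈U
      ... | true  = trans (cong (𝟙 ∘ isDominating G) (p∪⁅x⁆≡p U v v∈U)) (sym (+-identityʳ _))
      ... | false = refl

    𝟙-dom : ℕ → Subset n → ℕ
    𝟙-dom i S = 𝟙 (∣ S ∣ ≡ᵇ i) * 𝟙 (isDominating G S)

    d≡∑ˢ : ∀ i → d G i ≡ ∑ˢ (𝟙-dom i)
    d≡∑ˢ i = trans (countL-allSubsets (λ S → (∣ S ∣ ≡ᵇ i) ∧ isDominating G S))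
                   (∑ˢ-cong (λ S → 𝟙-∧ (∣ S ∣ ≡ᵇ i) (isDominating G S)))

    sumETDT≡∑ˢ-extensions : ∀ k →
      sumETDT G k ≡ ∑ˢ[ U ] (𝟙 (not (isDominating G U)) * (𝟙 (∣ U ∣ ≡ᵇ k) * extensions U))
    sumETDT≡∑ˢ-extensions k = begin
      sumETDT G k                                  ≡⟨ sum-map-allSubsets n _ ⟩
      ∑ˢ[ T ] (if nonemptyᵇ T then E G k T * D G T else 0)
                                                   ≡⟨ ∑ˢ-cong expand ⟩
      ∑ˢ[ T ] ∑ˢ[ U ] term U T                     ≡⟨ ∑ˢ-comm (λ T U → term U T) ⟩
      ∑ˢ[ U ] ∑ˢ[ T ] term U T                     ≡⟨ ∑ˢ-cong (λ U → ∑ˢ-delta (undominated U) (off-diagonal U)) ⟩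
      ∑ˢ[ U ] term U (undominated U)               ≡⟨ ∑ˢ-cong diagonal ⟩
      ∑ˢ[ U ] (𝟙 (not (isDominating G U)) * (𝟙 (∣ U ∣ ≡ᵇ k) * extensions U)) ∎
      where
      open ≡-Reasoning
      counted : Subset n → Subset n → Bool
      counted U T = (∣ U ∣ ≡ᵇ k) ∧ leavesExactly U T
      term : Subset n → Subset n → ℕ
      term U T = 𝟙 (nonemptyᵇ T) * (𝟙 (counted U T) * D G T)
      expand : ∀ T → (if nonemptyᵇ T then E G k T * D G T else 0) ≡ ∑ˢ[ U ] term U T
      expand T = begin
        (if nonemptyᵇ T then E G k T * D G T else 0)
          ≡⟨ if-then-0 (nonemptyᵇ T) _ ⟩
        𝟙 (nonemptyᵇ T) * (E G k T * D G T)
          ≡⟨ cong (λ e → 𝟙 (nonemptyᵇ T) * (e * D G T)) (countL-allSubsets (λ U → counted U T)) ⟩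
        𝟙 (nonemptyᵇ T) * (∑ˢ[ U ] 𝟙 (counted U T) * D G T)
          ≡⟨ cong (𝟙 (nonemptyᵇ T) *_) (*-distribʳ-∑ˢ (D G T) (λ U → 𝟙 (counted U T))) ⟩
        𝟙 (nonemptyᵇ T) * ∑ˢ[ U ] (𝟙 (counted U T) * D G T)
          ≡⟨ *-distribˡ-∑ˢ (𝟙 (nonemptyᵇ T)) (λ U → 𝟙 (counted U T) * D G T) ⟩
        ∑ˢ[ U ] term U T ∎
      off-diagonal : ∀ U T → T ≢ undominated U → term U T ≡ 0
      off-diagonal U T T≢T_U with counted U T in U-counted
      ... | true  = ⊥-elim (T≢T_U (leavesExactly⇒≡undominated U T
                                     (∧-conicalʳ (∣ U ∣ ≡ᵇ k) (leavesExactly U T) U-counted)))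
      ... | false = *-zeroʳ (𝟙 (nonemptyᵇ T))
      diagonal : ∀ U → term U (undominated U) ≡ 𝟙 (not (isDominating G U)) * (𝟙 (∣ U ∣ ≡ᵇ k) * extensions U)
      diagonal U = cong₂ (λ a x → 𝟙 a * x) (nonempty-undominated U) (cong₂ (λ c x → 𝟙 c * x) counted-T_U (D-undominated U))
        where
        counted-T_U : counted U (undominated U) ≡ (∣ U ∣ ≡ᵇ k)
        counted-T_U = trans (cong ((∣ U ∣ ≡ᵇ k) ∧_) (leavesExactly-undominated U)) (∧-identityʳ _)

    ∑ˢ-extensions-by-domination : ∀ k → ∑ˢ[ U ] (𝟙 (∣ U ∣ ≡ᵇ k) * extensions U) ≡ sumETDT G k + n * d G k
    ∑ˢ-extensions-by-domination k = sym (begin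
      sumETDT G k + n * d G k
        ≡⟨ cong₂ _+_ (sumETDT≡∑ˢ-extensions k) (trans (cong (n *_) (d≡∑ˢ k)) (*-distribˡ-∑ˢ n (𝟙-dom k))) ⟩
      ∑ˢ[ U ] (𝟙 (not (isDominating G U)) * X U) + ∑ˢ[ U ] (n * 𝟙-dom k U)
        ≡⟨ sym (∑ˢ-distrib-+ (λ U → 𝟙 (not (isDominating G U)) * X U) (λ U → n * 𝟙-dom k U)) ⟩
      ∑ˢ[ U ] (𝟙 (not (isDominating G U)) * X U + n * 𝟙-dom k U)
        ≡⟨ ∑ˢ-cong recombine ⟩
      ∑ˢ[ U ] X U ∎)
      where
      open ≡-Reasoning
      X : Subset n → ℕ
      X U = 𝟙 (∣ U ∣ ≡ᵇ k) * extensions U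
      recombine : ∀ U → 𝟙 (not (isDominating G U)) * X U + n * 𝟙-dom k U ≡ X U
      recombine U with isDominating G U in U-dom
      ... | true  = begin
        n * (𝟙 (∣ U ∣ ≡ᵇ k) * 1)          ≡⟨ cong (n *_) (*-identityʳ (𝟙 (∣ U ∣ ≡ᵇ k))) ⟩
        n * 𝟙 (∣ U ∣ ≡ᵇ k)                ≡⟨ *-comm n (𝟙 (∣ U ∣ ≡ᵇ k)) ⟩
        𝟙 (∣ U ∣ ≡ᵇ k) * n                ≡⟨ cong (𝟙 (∣ U ∣ ≡ᵇ k) *_) (sym (extensions-dominating U U-dom)) ⟩
        X U                               ∎
      ... | false = begin
        (X U + 0) + n * (𝟙 (∣ U ∣ ≡ᵇ k) * 0)  ≡⟨ cong₂ _+_ (+-identityʳ (X U)) (cong (n *_) (*-zeroʳ (𝟙 (∣ U ∣ ≡ᵇ k)))) ⟩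
        X U + n * 0                           ≡⟨ cong (X U +_) (*-zeroʳ n) ⟩
        X U + 0                               ≡⟨ +-identityʳ (X U) ⟩
        X U                                   ∎

    ∑ˢ-extensions-by-membership : ∀ k → ∑ˢ[ U ] (𝟙 (∣ U ∣ ≡ᵇ k) * extensions U) ≡ k * d G k + suc k * d G (suc k)
    ∑ˢ-extensions-by-membership k = begin
      ∑ˢ[ U ] (𝟙 (∣ U ∣ ≡ᵇ k) * extensions U)
        ≡⟨ ∑ˢ-cong split ⟩
      ∑ˢ[ U ] (k * 𝟙-dom k U + ∑[ v < n ] grown U v)
        ≡⟨ ∑ˢ-distrib-+ (λ U → k * 𝟙-dom k U) (λ U → ∑[ v < n ] grown U v) ⟩
      ∑ˢ[ U ] (k * 𝟙-dom k U) + ∑ˢ[ U ] ∑[ v < n ] grown U v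
        ≡⟨ cong₂ _+_ (sym (*-distribˡ-∑ˢ k (𝟙-dom k))) (∑ˢ-insertions (𝟙-dom (suc k))) ⟩
      k * ∑ˢ (𝟙-dom k) + ∑ˢ[ W ] (∣ W ∣ * 𝟙-dom (suc k) W)
        ≡⟨ cong (k * ∑ˢ (𝟙-dom k) +_) (∑ˢ-cong (λ W → *-𝟙≡ᵇ ∣ W ∣ (suc k) (𝟙 (isDominating G W)))) ⟩
      k * ∑ˢ (𝟙-dom k) + ∑ˢ[ W ] (suc k * 𝟙-dom (suc k) W)
        ≡⟨ cong (k * ∑ˢ (𝟙-dom k) +_) (sym (*-distribˡ-∑ˢ (suc k) (𝟙-dom (suc k)))) ⟩
      k * ∑ˢ (𝟙-dom k) + suc k * ∑ˢ (𝟙-dom (suc k))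
        ≡⟨ sym (cong₂ _+_ (cong (k *_) (d≡∑ˢ k)) (cong (suc k *_) (d≡∑ˢ (suc k)))) ⟩
      k * d G k + suc k * d G (suc k) ∎
      where
      open ≡-Reasoning
      outside grown : Subset n → Fin n → ℕ
      outside U v = if lookup U v then 0 else 𝟙 (isDominating G (U ∪ ⁅ v ⁆))
      grown U v = if lookup U v then 0 else 𝟙-dom (suc k) (U ∪ ⁅ v ⁆)
      grow : ∀ U v → 𝟙 (∣ U ∣ ≡ᵇ k) * outside U v ≡ grown U v
      grow U v with lookup U v in v∈U
      ... | true  = *-zeroʳ (𝟙 (∣ U ∣ ≡ᵇ k))
      ... | false = cong (λ s → 𝟙 (s ≡ᵇ suc k) * 𝟙 (isDominating G (U ∪ ⁅ v ⁆))) (sym (∣p∪⁅x⁆∣≡1+∣p∣ U v v∈U))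
      split : ∀ U → 𝟙 (∣ U ∣ ≡ᵇ k) * extensions U ≡ k * 𝟙-dom k U + ∑[ v < n ] grown U v
      split U = begin
        𝟙 (∣ U ∣ ≡ᵇ k) * extensions U
          ≡⟨ cong (𝟙 (∣ U ∣ ≡ᵇ k) *_) (extensions-split U) ⟩
        𝟙 (∣ U ∣ ≡ᵇ k) * (∣ U ∣ * 𝟙 (isDominating G U) + ∑[ v < n ] outside U v)
          ≡⟨ *-distribˡ-+ (𝟙 (∣ U ∣ ≡ᵇ k)) _ _ ⟩
        𝟙 (∣ U ∣ ≡ᵇ k) * (∣ U ∣ * 𝟙 (isDominating G U)) + 𝟙 (∣ U ∣ ≡ᵇ k) * ∑[ v < n ] outside U v
          ≡⟨ cong₂ _+_ (trans (x∙yz≈y∙xz (𝟙 (∣ U ∣ ≡ᵇ k)) ∣ U ∣ _) (*-𝟙≡ᵇ ∣ U ∣ k _))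
                       (trans (*-distribˡ-sum (𝟙 (∣ U ∣ ≡ᵇ k)) (outside U)) (sum-cong-≗ (grow U))) ⟩
        k * 𝟙-dom k U + ∑[ v < n ] grown U v ∎

    extensions-double-count : ∀ k → sumETDT G k + n * d G k ≡ k * d G k + suc k * d G (suc k)
    extensions-double-count k = trans (sym (∑ˢ-extensions-by-domination k)) (∑ˢ-extensions-by-membership k)

import Data.Nat as ℕ
open import Data.Integer using (ℤ; +_; _-_; _*_; _+_)
open import Data.Integer.Properties using (pos-+; pos-*)
open import Data.Integer.Tactic.RingSolver using (solve-∀)

rearrange : ∀ (A a b k n : ℤ) → A + n * a ≡ k * a + (+ 1 + k) * b →
            (+ 1 + k) * (b - a) ≡ A - ((+ 2 * k + + 1) - n) * a
rearrange A a b k n eq = begin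
  (+ 1 + k) * (b - a)                             ≡⟨ expand a b k ⟩
  (k * a + (+ 1 + k) * b) - (+ 2 * k + + 1) * a   ≡⟨ cong (_- (+ 2 * k + + 1) * a) (sym eq) ⟩
  (A + n * a) - (+ 2 * k + + 1) * a               ≡⟨ collect A a k n ⟩
  A - ((+ 2 * k + + 1) - n) * a                   ∎
  where
  open ≡-Reasoning
  expand : ∀ (a b k : ℤ) → (+ 1 + k) * (b - a) ≡ (k * a + (+ 1 + k) * b) - (+ 2 * k + + 1) * a
  expand = solve-∀
  collect : ∀ (A a k n : ℤ) → (A + n * a) - (+ 2 * k + + 1) * a ≡ A - ((+ 2 * k + + 1) - n) * a
  collect = solve-∀

rearrange-ℕ : ∀ A a b k n → A ℕ.+ n ℕ.* a ≡ k ℕ.* a ℕ.+ suc k ℕ.* b →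
              + suc k * (+ b - + a) ≡ + A - (+ (2 ℕ.* k ℕ.+ 1) - + n) * + a
rearrange-ℕ A a b k n eq = begin
  + suc k * (+ b - + a)
    ≡⟨ cong (_* (+ b - + a)) (pos-+ 1 k) ⟩
  (+ 1 + + k) * (+ b - + a)
    ≡⟨ rearrange (+ A) (+ a) (+ b) (+ k) (+ n) eqℤ ⟩
  + A - (+ 2 * + k + + 1 - + n) * + a
    ≡⟨ cong (λ c → + A - (c - + n) * + a) (sym (trans (pos-+ (2 ℕ.* k) 1) (cong (_+ + 1) (pos-* 2 k)))) ⟩
  + A - (+ (2 ℕ.* k ℕ.+ 1) - + n) * + a ∎
  where
  open ≡-Reasoning
  eqℤ : + A + + n * + a ≡ + k * + a + (+ 1 + + k) * + b
  eqℤ = begin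
    + A + + n * + a                ≡⟨ cong (_+_ (+ A)) (sym (pos-* n a)) ⟩
    + A + + (n ℕ.* a)              ≡⟨ sym (pos-+ A (n ℕ.* a)) ⟩
    + (A ℕ.+ n ℕ.* a)              ≡⟨ cong +_ eq ⟩
    + (k ℕ.* a ℕ.+ suc k ℕ.* b)    ≡⟨ pos-+ (k ℕ.* a) (suc k ℕ.* b) ⟩
    + (k ℕ.* a) + + (suc k ℕ.* b)  ≡⟨ cong₂ _+_ (pos-* k a) (trans (pos-* (suc k) b) (cong (_* + b) (pos-+ 1 k))) ⟩
    + k * + a + (+ 1 + + k) * + b  ∎

-- The identity holds for every k.
lemma2p2 : (n : ℕ) (G : Graph n) (k : ℕ) → k ≤ n →
    (+ (suc k)) * (+ d G (suc k) - + d G k)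
      ≡ + sumETDT G k - (+ (2 Data.Nat.* k Data.Nat.+ 1) - + n) * + d G k
lemma2p2 n G k _ = rearrange-ℕ (sumETDT G k) (d G k) (d G (suc k)) k n (extensions-double-count G k)
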